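{- Let $\sigma$ be a weakly consecutive permutation of $[k]$ and fix $d\in[k]$. Let $\ell$ be the least index in $[k]$ such that $d\mid\sigma(\ell)$. Then the map $D_d(\sigma):[\lfloor k/d\rfloor]\to[\lfloor k/d\rfloor]$ defined by $D_d(\sigma)(i)=\sigma(\ell+(i-1)d)/d$ is a weakly consecutive permutation of $[\lfloor k/d\rfloor]$.
   Context: $[k]=\{1,\dots,k\}$. A permutation $\sigma:[k]\to[k]$ is weakly consecutive if for all $i,j\in[k]$ and all integers $m$, whenever $m\mid\sigma(i)$ and $m\mid(i-j)$, also $m\mid\sigma(j)$. -}

module Defs where

open import Data.Nat using (ℕ; _≤_; _+_; _*_; _∸_; _/_; NonZero)
open import Data.Integer as ℤ using (ℤ; +_)
open import Data.Integer.Divisibility as ℤD using ()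
open import Data.Nat.Divisibility using (_∣_)
open import Data.Product using (_×_; ∃)
open import Relation.Binary.PropositionalEquality using (_≡_)

_∈[_] : ℕ → ℕ → Set
i ∈[ k ] = (1 ≤ i) × (i ≤ k)

-- σ : ℕ → ℕ restricts to a bijection [k] → [k]
-- (only the values on [k] matter)
IsPerm : ℕ → (ℕ → ℕ) → Set
IsPerm k σ =
  (∀ i → i ∈[ k ] → σ i ∈[ k ]) ×
  (∀ i j → i ∈[ k ] → j ∈[ k ] → σ i ≡ σ j → i ≡ j) ×
  (∀ j → j ∈[ k ] → ∃ λ i → i ∈[ k ] × σ i ≡ j)

WeaklyConsecutive : ℕ → (ℕ → ℕ) → Set
WeaklyConsecutive k σ =
  ∀ i j → i ∈[ k ] → j ∈[ k ] → (m : ℤ) →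
    m ℤD.∣ (+ σ i) → m ℤD.∣ ((+ i) ℤ.- (+ j)) → m ℤD.∣ (+ σ j)

IsLeastDivIndex : ℕ → (ℕ → ℕ) → ℕ → ℕ → Set
IsLeastDivIndex k σ d ℓ =
  ℓ ∈[ k ] × d ∣ σ ℓ × (∀ ℓ′ → ℓ′ ∈[ k ] → d ∣ σ ℓ′ → ℓ ≤ ℓ′)

D : (σ : ℕ → ℕ) (ℓ d : ℕ) .{{_ : NonZero d}} → ℕ → ℕ
D σ ℓ d i = σ (ℓ + (i ∸ 1) * d) / d

-- Taking m = d in weak consecutivity shows that the indices i with d ∣ σ(i) are closed under
-- moving by d inside [k]. Hence the least one satisfies ℓ ≤ d, all of ℓ, ℓ + d, …, ℓ + (⌊k/d⌋ − 1)d
-- lie in [k] and have σ-values divisible by d. Applying weak consecutivity of σ with the modulus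
-- c·d transfers it to D_d(σ), and injectivity of σ makes D_d(σ) an injective self-map of the
-- finite set [⌊k/d⌋], hence a permutation.
module Submission where

open import Defs
open import Data.Nat
  using (ℕ; zero; suc; z≤n; s≤s; _+_; _*_; _∸_; _/_; _≤_; _<_; _≟_; _≤?_; ∣_-_∣; NonZero; >-nonZero; >-nonZero⁻¹)
open import Data.Nat.Properties
open import Data.Nat.DivMod using (m/n*n≡m; m/n*n≤m; /-monoˡ-≤; /-cancelʳ-≡; m≥n⇒m/n>0)
open import Data.Nat.Divisibility using (_∣_; ∣-refl; ∣⇒≤; n∣m*n; *-monoˡ-∣; *-cancelʳ-∣)
open import Data.Integer as ℤ using (+_; _⊖_)
import Data.Integer.Properties as ℤ
open import Data.Product using (_×_; _,_; proj₁; proj₂; ∃)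
open import Function using (_∘_)
open import Relation.Binary.PropositionalEquality
open import Relation.Nullary using (Dec; yes; no; contradiction)

∣m⊖n∣≡∣m-n∣ : ∀ m n → ℤ.∣ m ⊖ n ∣ ≡ ∣ m - n ∣
∣m⊖n∣≡∣m-n∣ zero    zero    = refl
∣m⊖n∣≡∣m-n∣ zero    (suc n) = refl
∣m⊖n∣≡∣m-n∣ (suc m) zero    = refl
∣m⊖n∣≡∣m-n∣ (suc m) (suc n) = trans (cong ℤ.∣_∣ (ℤ.[1+m]⊖[1+n]≡m⊖n m n)) (∣m⊖n∣≡∣m-n∣ m n)

∣+m-+n∣≡∣m-n∣ : ∀ m n → ℤ.∣ + m ℤ.- + n ∣ ≡ ∣ m - n ∣
∣+m-+n∣≡∣m-n∣ m n = trans (cong ℤ.∣_∣ (ℤ.m-n≡m⊖n m n)) (∣m⊖n∣≡∣m-n∣ m n)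

MapsInto : ℕ → (ℕ → ℕ) → Set
MapsInto k f = ∀ i → i ∈[ k ] → f i ∈[ k ]

InjectiveOn : ℕ → (ℕ → ℕ) → Set
InjectiveOn k f = ∀ i j → i ∈[ k ] → j ∈[ k ] → f i ≡ f j → i ≡ j

SurjectiveOn : ℕ → (ℕ → ℕ) → Set
SurjectiveOn k f = ∀ j → j ∈[ k ] → ∃ λ i → i ∈[ k ] × f i ≡ j

-- Integer divisibility only sees absolute values, so weak consecutivity can be stated over ℕ.
WeaklyConsecutiveℕ : ℕ → (ℕ → ℕ) → Set
WeaklyConsecutiveℕ k σ =
  ∀ i j → i ∈[ k ] → j ∈[ k ] → ∀ c → c ∣ σ i → c ∣ ∣ i - j ∣ → c ∣ σ j

weaklyConsecutive⇒ℕ : ∀ {k σ} → WeaklyConsecutive k σ → WeaklyConsecutiveℕ k σ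
weaklyConsecutive⇒ℕ wc i j i∈ j∈ c c∣σi c∣∣i-j∣ =
  wc i j i∈ j∈ (+ c) c∣σi (subst (c ∣_) (sym (∣+m-+n∣≡∣m-n∣ i j)) c∣∣i-j∣)

weaklyConsecutive⇐ℕ : ∀ {k σ} → WeaklyConsecutiveℕ k σ → WeaklyConsecutive k σ
weaklyConsecutive⇐ℕ wc i j i∈ j∈ m m∣σi m∣i-j =
  wc i j i∈ j∈ ℤ.∣ m ∣ m∣σi (subst (ℤ.∣ m ∣ ∣_) (∣+m-+n∣≡∣m-n∣ i j) m∣i-j)

∈[]-weaken : ∀ {i n} → i ∈[ n ] → i ∈[ suc n ]
∈[]-weaken (1≤i , i≤n) = 1≤i , m≤n⇒m≤1+n i≤n

∈[]-strengthen : ∀ {i n} → i ∈[ suc n ] → i ≢ suc n → i ∈[ n ]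
∈[]-strengthen (1≤i , i≤1+n) i≢1+n = 1≤i , m<1+n⇒m≤n (≤∧≢⇒< i≤1+n i≢1+n)

∈[]⇒≢1+n : ∀ {i n} → i ∈[ n ] → i ≢ suc n
∈[]⇒≢1+n (_ , i≤n) = <⇒≢ (s≤s i≤n)

transpose : ℕ → ℕ → ℕ → ℕ
transpose a b y with y ≟ a | y ≟ b
... | yes _ | _     = b
... | no _  | yes _ = a
... | no _  | no _  = y

transpose-a : ∀ a b → transpose a b a ≡ b
transpose-a a b with a ≟ a | a ≟ b
... | yes _   | _ = refl
... | no a≢a  | _ = contradiction refl a≢a

transpose-b : ∀ a b → transpose a b b ≡ a
transpose-b a b with b ≟ a | b ≟ b
... | yes b≡a | _     = b≡a
... | no _    | yes _ = refl
... | no _    | no b≢b = contradiction refl b≢b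

transpose-other : ∀ {a b y} → y ≢ a → y ≢ b → transpose a b y ≡ y
transpose-other {a} {b} {y} y≢a y≢b with y ≟ a | y ≟ b
... | yes y≡a | _       = contradiction y≡a y≢a
... | no _    | yes y≡b = contradiction y≡b y≢b
... | no _    | no _    = refl

transpose-involutive : ∀ a b y → transpose a b (transpose a b y) ≡ y
transpose-involutive a b y = by-cases (y ≟ a) (y ≟ b)
  where
  τ² : ℕ → ℕ
  τ² = transpose a b ∘ transpose a b

  by-cases : Dec (y ≡ a) → Dec (y ≡ b) → τ² y ≡ y
  by-cases (yes y≡a) _ = subst (λ z → τ² z ≡ z) (sym y≡a)
    (trans (cong (transpose a b) (transpose-a a b)) (transpose-b a b))
  by-cases (no _) (yes y≡b) = subst (λ z → τ² z ≡ z) (sym y≡b)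
    (trans (cong (transpose a b) (transpose-b a b)) (transpose-a a b))
  by-cases (no y≢a) (no y≢b) =
    trans (cong (transpose a b) (transpose-other y≢a y≢b)) (transpose-other y≢a y≢b)

transpose-injective : ∀ {a b x y} → transpose a b x ≡ transpose a b y → x ≡ y
transpose-injective {a} {b} {x} {y} eq = begin
  x                                   ≡⟨ transpose-involutive a b x ⟨
  transpose a b (transpose a b x)     ≡⟨ cong (transpose a b) eq ⟩
  transpose a b (transpose a b y)     ≡⟨ transpose-involutive a b y ⟩
  y                                   ∎
  where open ≡-Reasoning

transpose-preserves : ∀ {p} (P : ℕ → Set p) {a b y} → P a → P b → P y → P (transpose a b y)
transpose-preserves P {a} {b} {y} Pa Pb Py with y ≟ a | y ≟ b
... | yes _ | _     = Pb
... | no _  | yes _ = Pa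
... | no _  | no _  = Py

-- Composing with the transposition of f(n+1) and n+1 yields an injective self-map of [n].
injective⇒surjective : ∀ n f → MapsInto n f → InjectiveOn n f → SurjectiveOn n f
injective⇒surjective zero    f _      _     j (1≤j , j≤0) = contradiction j≤0 (<⇒≱ 1≤j)
injective⇒surjective (suc n) f f-maps f-inj j j∈ = preimage (τ j ≟ suc n)
  where
  top : suc n ∈[ suc n ]
  top = s≤s z≤n , ≤-refl

  τ : ℕ → ℕ
  τ = transpose (f (suc n)) (suc n)

  τ-maps : MapsInto (suc n) τ
  τ-maps y = transpose-preserves (_∈[ suc n ]) (f-maps (suc n) top) top

  g-maps : MapsInto n (τ ∘ f)
  g-maps i i∈ = ∈[]-strengthen (τ-maps (f i) (f-maps i (∈[]-weaken i∈))) g[i]≢1+n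
    where
    g[i]≢1+n : τ (f i) ≢ suc n
    g[i]≢1+n g[i]≡1+n = ∈[]⇒≢1+n i∈ (f-inj i (suc n) (∈[]-weaken i∈) top
      (transpose-injective (trans g[i]≡1+n (sym (transpose-a (f (suc n)) (suc n))))))

  g-injective : InjectiveOn n (τ ∘ f)
  g-injective i i′ i∈ i′∈ eq = f-inj i i′ (∈[]-weaken i∈) (∈[]-weaken i′∈) (transpose-injective eq)

  preimage : Dec (τ j ≡ suc n) → ∃ λ i → i ∈[ suc n ] × f i ≡ j
  preimage (yes τj≡1+n) = suc n , top , (begin
    f (suc n)     ≡⟨ transpose-b (f (suc n)) (suc n) ⟨
    τ (suc n)     ≡⟨ cong τ τj≡1+n ⟨
    τ (τ j)       ≡⟨ transpose-involutive (f (suc n)) (suc n) j ⟩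
    j             ∎)
    where open ≡-Reasoning
  preimage (no τj≢1+n) with injective⇒surjective n (τ ∘ f) g-maps g-injective
                              (τ j) (∈[]-strengthen (τ-maps j j∈) τj≢1+n)
  ... | i , i∈ , τfi≡τj = i , ∈[]-weaken i∈ , transpose-injective τfi≡τj

module _ {k} {σ : ℕ → ℕ} (wc : WeaklyConsecutiveℕ k σ) where

  ∣σ-shift : ∀ {c x n} → x ∈[ k ] → (x + n) ∈[ k ] → c ∣ n → c ∣ σ x → c ∣ σ (x + n)
  ∣σ-shift {c} {x} {n} x∈ x+n∈ c∣n c∣σx =
    wc _ _ x∈ x+n∈ c c∣σx (subst (c ∣_) (sym (∣m-m+n∣≡n x n)) c∣n)

  ∣σ-unshift : ∀ {c x n} → x ∈[ k ] → (x + n) ∈[ k ] → c ∣ n → c ∣ σ (x + n) → c ∣ σ x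
  ∣σ-unshift {c} {x} {n} x∈ x+n∈ c∣n c∣σ[x+n] =
    wc _ _ x+n∈ x∈ c c∣σ[x+n] (subst (c ∣_) (sym (trans (∣-∣-comm (x + n) x) (∣m-m+n∣≡n x n))) c∣n)

module Contraction {k} {σ : ℕ → ℕ} (σ-maps : MapsInto k σ) (σ-injective : InjectiveOn k σ)
                   (σ-wc : WeaklyConsecutiveℕ k σ) (d : ℕ) .{{_ : NonZero d}} {ℓ}
                   (ℓ-least : IsLeastDivIndex k σ d ℓ) where

  ℓ∈[k] : ℓ ∈[ k ]
  ℓ∈[k] = proj₁ ℓ-least

  d∣σℓ : d ∣ σ ℓ
  d∣σℓ = proj₁ (proj₂ ℓ-least)

  ℓ≤d : ℓ ≤ d
  ℓ≤d with ℓ ≤? d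
  ... | yes ℓ≤d = ℓ≤d
  ... | no  ℓ≰d = contradiction (proj₂ (proj₂ ℓ-least) (ℓ ∸ d) ℓ∸d∈[k] d∣σ[ℓ∸d]) (<⇒≱ ℓ∸d<ℓ)
    where
    d<ℓ : d < ℓ
    d<ℓ = ≰⇒> ℓ≰d

    ℓ∸d<ℓ : ℓ ∸ d < ℓ
    ℓ∸d<ℓ = ∸-monoʳ-< (>-nonZero⁻¹ d) (<⇒≤ d<ℓ)

    ℓ∸d∈[k] : (ℓ ∸ d) ∈[ k ]
    ℓ∸d∈[k] = m<n⇒0<n∸m d<ℓ , ≤-trans (m∸n≤m ℓ d) (proj₂ ℓ∈[k])

    ℓ≡ℓ∸d+d : ℓ ≡ ℓ ∸ d + d
    ℓ≡ℓ∸d+d = sym (m∸n+n≡m (<⇒≤ d<ℓ))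

    d∣σ[ℓ∸d] : d ∣ σ (ℓ ∸ d)
    d∣σ[ℓ∸d] = ∣σ-unshift σ-wc ℓ∸d∈[k] (subst (_∈[ k ]) ℓ≡ℓ∸d+d ℓ∈[k]) ∣-refl
                 (subst (λ x → d ∣ σ x) ℓ≡ℓ∸d+d d∣σℓ)

  node : ℕ → ℕ
  node i = ℓ + (i ∸ 1) * d

  node∈[k] : ∀ {i} → i ∈[ k / d ] → node i ∈[ k ]
  node∈[k] {suc i} (_ , 1+i≤k/d) = ≤-trans (proj₁ ℓ∈[k]) (m≤m+n ℓ (i * d)) , (begin
    ℓ + i * d       ≤⟨ +-monoˡ-≤ (i * d) ℓ≤d ⟩
    suc i * d       ≤⟨ *-monoˡ-≤ d 1+i≤k/d ⟩
    k / d * d       ≤⟨ m/n*n≤m k d ⟩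
    k               ∎)
    where open ≤-Reasoning

  node-injective : ∀ i j → node (suc i) ≡ node (suc j) → suc i ≡ suc j
  node-injective i j eq = cong suc (*-cancelʳ-≡ i j d (+-cancelˡ-≡ ℓ _ _ eq))

  ∣node-node∣ : ∀ i j → ∣ node (suc i) - node (suc j) ∣ ≡ ∣ suc i - suc j ∣ * d
  ∣node-node∣ i j = trans (∣m+n-m+o∣≡∣n-o∣ ℓ (i * d) (j * d)) (sym (*-distribʳ-∣-∣ d i j))

  d∣σ[node] : ∀ {i} → i ∈[ k / d ] → d ∣ σ (node i)
  d∣σ[node] {i} i∈ = ∣σ-shift σ-wc ℓ∈[k] (node∈[k] i∈) (n∣m*n (i ∸ 1)) d∣σℓ

  D*d≡σ[node] : ∀ {i} → i ∈[ k / d ] → D σ ℓ d i * d ≡ σ (node i)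
  D*d≡σ[node] i∈ = m/n*n≡m (d∣σ[node] i∈)

  D-maps : MapsInto (k / d) (D σ ℓ d)
  D-maps i i∈ =
    m≥n⇒m/n>0 (∣⇒≤ {{>-nonZero (proj₁ σ[node]∈[k])}} (d∣σ[node] i∈)) , /-monoˡ-≤ d (proj₂ σ[node]∈[k])
    where
    σ[node]∈[k] : σ (node i) ∈[ k ]
    σ[node]∈[k] = σ-maps (node i) (node∈[k] i∈)

  D-injective : InjectiveOn (k / d) (D σ ℓ d)
  D-injective zero    _       (() , _) _
  D-injective _       zero    _        (() , _)
  D-injective (suc i) (suc j) i∈ j∈ Di≡Dj = node-injective i j
    (σ-injective _ _ (node∈[k] i∈) (node∈[k] j∈) (/-cancelʳ-≡ (d∣σ[node] i∈) (d∣σ[node] j∈) Di≡Dj))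

  D-weaklyConsecutive : WeaklyConsecutiveℕ (k / d) (D σ ℓ d)
  D-weaklyConsecutive zero    _       (() , _) _
  D-weaklyConsecutive _       zero    _        (() , _)
  D-weaklyConsecutive (suc i) (suc j) i∈ j∈ c c∣Di c∣∣i-j∣ =
    *-cancelʳ-∣ d (subst (c * d ∣_) (sym (D*d≡σ[node] j∈)) cd∣σ[node-j])
    where
    cd∣σ[node-i] : c * d ∣ σ (node (suc i))
    cd∣σ[node-i] = subst (c * d ∣_) (D*d≡σ[node] i∈) (*-monoˡ-∣ d c∣Di)

    cd∣∣node-node∣ : c * d ∣ ∣ node (suc i) - node (suc j) ∣
    cd∣∣node-node∣ = subst (c * d ∣_) (sym (∣node-node∣ i j)) (*-monoˡ-∣ d c∣∣i-j∣)

    cd∣σ[node-j] : c * d ∣ σ (node (suc j))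
    cd∣σ[node-j] = σ-wc _ _ (node∈[k] i∈) (node∈[k] j∈) (c * d) cd∣σ[node-i] cd∣∣node-node∣

mainTheorem6 : (k : ℕ) (σ : ℕ → ℕ) → IsPerm k σ → WeaklyConsecutive k σ →
    (d : ℕ) .{{_ : NonZero d}} → d ∈[ k ] →
    (ℓ : ℕ) → IsLeastDivIndex k σ d ℓ →
    IsPerm (k / d) (D σ ℓ d) × WeaklyConsecutive (k / d) (D σ ℓ d)
mainTheorem6 k σ (σ-maps , σ-injective , _) σ-wc d _ ℓ ℓ-least =
  (D-maps , D-injective , injective⇒surjective (k / d) (D σ ℓ d) D-maps D-injective) ,
  weaklyConsecutive⇐ℕ D-weaklyConsecutive
  where open Contraction σ-maps σ-injective (weaklyConsecutive⇒ℕ σ-wc) d ℓ-least
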